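{- For $1\le i\le 2n$ and $a\in\mathbb R$ let $u_i(a)=x_i(a)y_{i-1}(a)=y_{i-1}(a)x_i(a)\in GL_{2n}$. Then for all real $a,b,c$ (with $a+c+abc\neq0$ in (3)): (1) $u_i(a)u_i(b)=u_i(a+b)$; (2) $u_i(a)u_j(b)=u_j(b)u_i(a)$ whenever $|i-j|\ge2$; (3) $u_i(a)u_{i\pm1}(b)u_i(c)=u_{i\pm1}\!\left(\frac{bc}{a+c+abc}\right)u_i(a+c+abc)\,u_{i\pm1}\!\left(\frac{ab}{a+c+abc}\right)$.
   Context: Fix $n$. Indices of matrix positions and of the generators are taken modulo $2n$. For $a\in\mathbb R$ and $i\in\mathbb Z/2n$, $x_i(a)\in GL_{2n}$ is the matrix differing from the identity only by the entry $a$ in row $i$, column $i+1$ (so $x_{2n}(a)$ has $a$ in row $2n$, column $1$), and $y_i(a)$ differs from the identity only by the entry $a$ in row $i+1$, column $i$ (so $y_{0}(a)=y_{2n}(a)$ has $a$ in row $1$, column $2n$). -}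

module Defs where

open import Level using (_⊔_)
open import Data.Nat as ℕ using (ℕ; zero; suc)
open import Data.Fin using (Fin; zero; suc; toℕ; fromℕ; fromℕ<; inject₁; _≟_)
open import Relation.Nullary using (yes; no; does)
open import Data.Bool using (if_then_else_; _∧_)
open import Algebra.Bundles using (CommutativeRing)

csuc : ∀ {m} → Fin m → Fin m
csuc {suc m} i with toℕ i ℕ.<? m
... | yes p = suc (fromℕ< p)
... | no _ = zero

cpred : ∀ {m} → Fin m → Fin m
cpred {suc m} zero = fromℕ m
cpred {suc m} (suc j) = inject₁ j

-- Square m×m matrices over a commutative ring R, with positions indexed
-- by Fin m (position k stands for the label k modulo m).
module Matrices {c ℓ} (R : CommutativeRing c ℓ) (m : ℕ) where
  open CommutativeRing R using (Carrier; _≈_; _+_; _*_; 0#; 1#)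

  Mat : Set c
  Mat = Fin m → Fin m → Carrier

  Σ : ∀ {k} → (Fin k → Carrier) → Carrier
  Σ {zero} f = 0#
  Σ {suc k} f = f zero + Σ (λ j → f (suc j))

  infixl 7 _⊗_
  _⊗_ : Mat → Mat → Mat
  (A ⊗ B) i j = Σ (λ k → A i k * B k j)

  infix 4 _≋_
  _≋_ : Mat → Mat → Set ℓ
  A ≋ B = ∀ i j → A i j ≈ B i j

  δ : Fin m → Fin m → Carrier
  δ k l = if does (k ≟ l) then 1# else 0#

  -- identity plus the entry a in row r, column s (r ≠ s in all uses)
  elem : Fin m → Fin m → Carrier → Mat
  elem r s a k l = δ k l + (if does (k ≟ r) ∧ does (l ≟ s) then a else 0#)

  x : Fin m → Carrier → Mat
  x i a = elem i (csuc i) a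

  y : Fin m → Carrier → Mat
  y i a = elem (csuc i) i a

  u : Fin m → Carrier → Mat
  u i a = x i a ⊗ y (cpred i) a

module Submission where

-- Write e_i for the i-th unit row and ν_i = e_{i+1} + e_{i-1}
-- for the indicator of the two cyclic neighbours of i.  The generator
-- u_i(a) = x_i(a) y_{i-1}(a) is the matrix I + a e_iᵀ ν_i, so multiplying a
-- matrix on the right by u_i(a) is the row operation ρ ↦ ρ + ρ_i (a ν_i),
-- applied to every row ρ ("transvect" below).  All three relations are
-- therefore identities between composites of such row operations, and they
-- only depend on the values ν_i(i) = 0, ν_i(j) = 0 for non-adjacent j, and
-- ν_i(j) = 1 for adjacent j.

open import Defs
open import Data.Nat as ℕ using (ℕ; _≤_)
open import Data.Fin using (Fin)
open import Data.Product using (_×_)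
open import Relation.Binary.PropositionalEquality using (_≢_)
open import Algebra.Bundles using (CommutativeRing)

open import Data.Nat using (zero; suc; z≤n; s≤s)
open import Data.Nat.Properties using (≤∧≮⇒≡; ≤-trans; <-irrefl; m≤n⇒m≤o+n)
open import Data.Fin using (zero; suc; toℕ; fromℕ; fromℕ<; inject₁; _≟_)
open import Data.Fin.Properties
  using (toℕ-injective; toℕ-fromℕ<; toℕ-fromℕ; toℕ-inject₁; toℕ≤pred[n]; toℕ<n)
open import Data.Vec.Functional using (Vector; map; zipWith)
open import Data.Product using (_,_)
open import Data.Empty using (⊥)
open import Function using (_∘_)
open import Relation.Nullary using (yes; no; contradiction)
open import Relation.Binary.PropositionalEquality
  using (_≡_; cong; subst)
  renaming (refl to ≡-refl; sym to ≡-sym; trans to ≡-trans)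

data CyclicStep (M : ℕ) : ℕ → ℕ → Set where
  up   : ∀ {v} → CyclicStep M v (suc v)
  wrap : CyclicStep M M 0

toℕ-csuc : ∀ {M} (i : Fin (suc M)) → CyclicStep M (toℕ i) (toℕ (csuc i))
toℕ-csuc {M} i with toℕ i ℕ.<? M
... | yes i<M rewrite toℕ-fromℕ< i<M = up
... | no i≮M rewrite ≤∧≮⇒≡ (toℕ≤pred[n] i) i≮M = wrap

csuc-no-fixpoint : ∀ {M} → 1 ≤ M → (i : Fin (suc M)) → csuc i ≢ i
csuc-no-fixpoint {M} 1≤M i csuc-i≡i =
  moves 1≤M (subst (CyclicStep M (toℕ i)) (cong toℕ csuc-i≡i) (toℕ-csuc i))
  where
  moves : ∀ {v} → 1 ≤ M → CyclicStep M v v → ⊥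
  moves () wrap

csuc²-no-fixpoint : ∀ {M} → 2 ≤ M → (i : Fin (suc M)) → csuc (csuc i) ≢ i
csuc²-no-fixpoint {M} 2≤M i csuc²-i≡i =
  no-2-cycle 2≤M (toℕ-csuc i)
    (subst (CyclicStep M (toℕ (csuc i))) (cong toℕ csuc²-i≡i) (toℕ-csuc (csuc i)))
  where
  no-2-cycle : ∀ {v w} → 2 ≤ M → CyclicStep M v w → CyclicStep M w v → ⊥
  no-2-cycle (s≤s ()) up wrap
  no-2-cycle (s≤s ()) wrap up

csuc-cpred : ∀ {M} (i : Fin (suc M)) → csuc (cpred i) ≡ i
csuc-cpred {M} zero with toℕ (fromℕ M) ℕ.<? M
... | yes M<M = contradiction (subst (ℕ._< M) (toℕ-fromℕ M) M<M) (<-irrefl ≡-refl)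
... | no _ = ≡-refl
csuc-cpred {suc M} (suc j) with toℕ (inject₁ j) ℕ.<? suc M
... | yes j<M = cong suc (toℕ-injective (≡-trans (toℕ-fromℕ< j<M) (toℕ-inject₁ j)))
... | no j≮M = contradiction (subst (ℕ._< suc M) (≡-sym (toℕ-inject₁ j)) (toℕ<n j)) j≮M

cpred-csuc : ∀ {M} (i : Fin (suc M)) → cpred (csuc i) ≡ i
cpred-csuc {M} i with toℕ i ℕ.<? M
... | yes i<M = toℕ-injective (≡-trans (toℕ-inject₁ (fromℕ< i<M)) (toℕ-fromℕ< i<M))
... | no i≮M = toℕ-injective (≡-trans (toℕ-fromℕ M) (≡-sym (≤∧≮⇒≡ (toℕ≤pred[n] i) i≮M)))

module RowOperations {c ℓ} (R : CommutativeRing c ℓ) {m : ℕ} where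
  open CommutativeRing R
  open import Algebra.Solver.Ring.NaturalCoefficients.Default commutativeSemiring
    using (solve; _:=_; _:+_; _:*_)
  open import Algebra.Properties.CommutativeSemigroup +-commutativeSemigroup using (xy∙z≈xz∙y)
  open import Data.Vec.Functional.Relation.Binary.Equality.Setoid setoid
    using () renaming (_≋_ to _≐_)
  open import Relation.Binary.Reasoning.Setoid setoid

  Row : Set c
  Row = Vector Carrier m

  infixr 7 _·_
  _·_ : Carrier → Row → Row
  a · v = map (a *_) v

  transvect : Row → Fin m → Row → Row
  transvect ρ i v l = ρ l + ρ i * v l

  scale-vanishes : ∀ a (v : Row) j → v j ≈ 0# → (a · v) j ≈ 0#
  scale-vanishes a v j v≈0 = trans (*-congˡ v≈0) (zeroʳ a)

  transvect-fixes : ∀ ρ i v {j} → v j ≈ 0# → transvect ρ i v j ≈ ρ j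
  transvect-fixes ρ i v v≈0 = trans (+-congˡ (trans (*-congˡ v≈0) (zeroʳ (ρ i)))) (+-identityʳ _)

  transvect-merge : ∀ ρ i v w → v i ≈ 0# →
    transvect (transvect ρ i v) i w ≐ transvect ρ i (zipWith _+_ v w)
  transvect-merge ρ i v w v≈0 l = begin
    ρ l + ρ i * v l + transvect ρ i v i * w l  ≈⟨ +-congˡ (*-congʳ (transvect-fixes ρ i v v≈0)) ⟩
    ρ l + ρ i * v l + ρ i * w l                ≈⟨ +-assoc _ _ _ ⟩
    ρ l + (ρ i * v l + ρ i * w l)              ≈⟨ +-congˡ (sym (distribˡ (ρ i) (v l) (w l))) ⟩
    ρ l + ρ i * (v l + w l)                    ∎

  transvect-comm : ∀ ρ i j v w → v j ≈ 0# → w i ≈ 0# →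
    transvect (transvect ρ i v) j w ≐ transvect (transvect ρ j w) i v
  transvect-comm ρ i j v w vj≈0 wi≈0 l = begin
    ρ l + ρ i * v l + transvect ρ i v j * w l  ≈⟨ +-congˡ (*-congʳ (transvect-fixes ρ i v vj≈0)) ⟩
    ρ l + ρ i * v l + ρ j * w l                ≈⟨ xy∙z≈xz∙y _ _ _ ⟩
    ρ l + ρ j * w l + ρ i * v l                ≈⟨ +-congˡ (*-congʳ (transvect-fixes ρ j w wi≈0)) ⟨
    ρ l + ρ j * w l + transvect ρ j w i * v l  ∎

  transvect-triple : ∀ ρ i j v w a b c → v i ≈ 0# → v j ≈ 1# → w i ≈ 1# → ∀ l →
    transvect (transvect (transvect ρ i (a · v)) j (b · w)) i (c · v) l
      ≈ ρ l + ρ i * ((a + c + a * b * c) * v l + a * b * w l) + ρ j * (b * w l + b * c * v l)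
  transvect-triple ρ i j v w a b c vi≈0 vj≈1 wi≈1 l = begin
    σ₂ l + σ₂ i * (c * v l)
      ≈⟨ +-cong (+-congˡ (*-congʳ σ₁-j)) (*-congʳ σ₂-i) ⟩
    ρ l + ρ i * (a * v l) + (ρ j + ρ i * a) * (b * w l) + (ρ i + (ρ j + ρ i * a) * b) * (c * v l)
      ≈⟨ normalise (ρ l) (ρ i) (ρ j) a b c (v l) (w l) ⟩
    ρ l + ρ i * ((a + c + a * b * c) * v l + a * b * w l) + ρ j * (b * w l + b * c * v l) ∎
    where
    σ₁ = transvect ρ i (a · v)
    σ₂ = transvect σ₁ j (b · w)
    σ₁-j : σ₁ j ≈ ρ j + ρ i * a
    σ₁-j = +-congˡ (*-congˡ (trans (*-congˡ vj≈1) (*-identityʳ a)))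
    σ₂-i : σ₂ i ≈ ρ i + (ρ j + ρ i * a) * b
    σ₂-i = +-cong (transvect-fixes ρ i (a · v) (scale-vanishes a v i vi≈0))
                  (*-cong σ₁-j (trans (*-congˡ wi≈1) (*-identityʳ b)))
    normalise : ∀ x y z a b c p q →
      x + y * (a * p) + (z + y * a) * (b * q) + (y + (z + y * a) * b) * (c * p)
        ≈ x + y * ((a + c + a * b * c) * p + a * b * q) + z * (b * q + b * c * p)
    normalise = solve 8 (λ x y z a b c p q →
      x :+ y :* (a :* p) :+ (z :+ y :* a) :* (b :* q) :+ (y :+ (z :+ y :* a) :* b) :* (c :* p)
        := x :+ y :* ((a :+ c :+ a :* b :* c) :* p :+ a :* b :* q) :+ z :* (b :* q :+ b :* c :* p)) refl

  module BraidCoefficients (a b c d : Carrier) (inverse : (a + c + a * b * c) * d ≈ 1#) where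
    q = a + c + a * b * c

    times-inverse : ∀ x → x * (q * d) ≈ x
    times-inverse x = trans (*-congˡ inverse) (*-identityʳ x)

    right-left : q * (a * b * d) ≈ a * b
    right-left = trans (solve 4 (λ a b q d → q :* (a :* b :* d) := a :* b :* (q :* d)) refl a b q d)
                       (times-inverse (a * b))

    left-right : b * c * d * q ≈ b * c
    left-right = trans (solve 4 (λ b c q d → b :* c :* d :* q := b :* c :* (q :* d)) refl b c q d)
                       (times-inverse (b * c))

    middle : b * c * d + a * b * d + b * c * d * q * (a * b * d) ≈ b
    middle = begin
      b * c * d + a * b * d + b * c * d * q * (a * b * d)
        ≈⟨ solve 5 (λ a b c d q → b :* c :* d :+ a :* b :* d :+ b :* c :* d :* q :* (a :* b :* d)
                                := b :* d :* (a :+ c) :+ a :* b :* b :* c :* d :* (q :* d)) refl a b c d q ⟩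
      b * d * (a + c) + a * b * b * c * d * (q * d)
        ≈⟨ +-congˡ (times-inverse (a * b * b * c * d)) ⟩
      b * d * (a + c) + a * b * b * c * d
        ≈⟨ solve 4 (λ a b c d → b :* d :* (a :+ c) :+ a :* b :* b :* c :* d
                              := b :* ((a :+ c :+ a :* b :* c) :* d)) refl a b c d ⟩
      b * (q * d)
        ≈⟨ times-inverse b ⟩
      b ∎

  transvect-braid : ∀ ρ i j v w a b c d →
    v i ≈ 0# → v j ≈ 1# → w i ≈ 1# → w j ≈ 0# → (a + c + a * b * c) * d ≈ 1# →
    transvect (transvect (transvect ρ i (a · v)) j (b · w)) i (c · v)
      ≐ transvect (transvect (transvect ρ j ((b * c * d) · w)) i ((a + c + a * b * c) · v)) j ((a * b * d) · w)
  transvect-braid ρ i j v w a b c d vi≈0 vj≈1 wi≈1 wj≈0 inverse l = begin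
    transvect (transvect (transvect ρ i (a · v)) j (b · w)) i (c · v) l
      ≈⟨ transvect-triple ρ i j v w a b c vi≈0 vj≈1 wi≈1 l ⟩
    ρ l + ρ i * (q * v l + a * b * w l) + ρ j * (b * w l + b * c * v l)
      ≈⟨ xy∙z≈xz∙y _ _ _ ⟩
    ρ l + ρ j * (b * w l + b * c * v l) + ρ i * (q * v l + a * b * w l)
      ≈⟨ +-cong (+-congˡ (*-congˡ (+-cong (*-congʳ (sym middle)) (*-congʳ (sym left-right)))))
                (*-congˡ (+-congˡ (*-congʳ (sym right-left)))) ⟩
    ρ l + ρ j * ((p + r + p * q * r) * w l + p * q * v l) + ρ i * (q * v l + q * r * w l)
      ≈⟨ transvect-triple ρ j i w v p q r wj≈0 wi≈1 vj≈1 l ⟨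
    transvect (transvect (transvect ρ j (p · w)) i (q · v)) j (r · w) l ∎
    where
    open BraidCoefficients a b c d inverse
    p = b * c * d
    r = a * b * d

module MatrixProducts {c ℓ} (R : CommutativeRing c ℓ) (m : ℕ) where
  open CommutativeRing R hiding (zero)
  open Matrices R m
  open RowOperations R {m}
  open import Algebra.Properties.Semiring.Sum semiring
    using (sum; sum-cong-≋; sum-replicate-zero; ∑-distrib-+; *-distribʳ-sum)
  open import Relation.Binary.Reasoning.Setoid setoid

  I : Mat
  I k l = δ k l

  unit : Fin m → Row
  unit s l = δ l s

  infix 6 _◃_∣_
  _◃_∣_ : Mat → Fin m → Row → Mat
  (N ◃ i ∣ v) k = transvect (N k) i v

  δ-diag : ∀ k → δ k k ≈ 1#
  δ-diag k with k ≟ k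
  ... | yes _ = refl
  ... | no k≢k = contradiction ≡-refl k≢k

  δ-off-diag : ∀ {k l} → k ≢ l → δ k l ≈ 0#
  δ-off-diag {k} {l} k≢l with k ≟ l
  ... | yes k≡l = contradiction k≡l k≢l
  ... | no _ = refl

  Σ≡sum : ∀ {k} (f : Vector Carrier k) → Σ f ≡ sum f
  Σ≡sum {zero} f = ≡-refl
  Σ≡sum {suc k} f = cong (f zero +_) (Σ≡sum (f ∘ suc))

  Σ-cong : ∀ {k} {f g : Vector Carrier k} → (∀ t → f t ≈ g t) → Σ f ≈ Σ g
  Σ-cong {f = f} {g} f≈g =
    trans (reflexive (Σ≡sum f)) (trans (sum-cong-≋ f≈g) (reflexive (≡-sym (Σ≡sum g))))

  sum-unit : ∀ {k} (f : Vector Carrier k) l → sum (λ t → f t * Matrices.δ R k t l) ≈ f l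
  sum-unit {suc k} f zero =
    trans (+-cong (*-identityʳ (f zero))
                  (trans (sum-cong-≋ (λ t → zeroʳ (f (suc t)))) (sum-replicate-zero k)))
          (+-identityʳ (f zero))
  sum-unit {suc k} f (suc l) = trans (+-cong (zeroʳ (f zero)) (sum-unit (f ∘ suc) l)) (+-identityˡ _)

  ⊗-cong : ∀ {A A' B B'} → A ≋ A' → B ≋ B' → A ⊗ B ≋ A' ⊗ B'
  ⊗-cong A≋A' B≋B' k l = Σ-cong (λ t → *-cong (A≋A' k t) (B≋B' t l))

  ⊗-transvection : ∀ N i v → N ⊗ (I ◃ i ∣ v) ≋ N ◃ i ∣ v
  ⊗-transvection N i v k l = begin
    Σ (λ t → N k t * (δ t l + δ t i * v l))
      ≡⟨ Σ≡sum (λ t → N k t * (δ t l + δ t i * v l)) ⟩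
    sum (λ t → N k t * (δ t l + δ t i * v l))
      ≈⟨ sum-cong-≋ (λ t → trans (distribˡ (N k t) (δ t l) (δ t i * v l))
                                       (+-congˡ (sym (*-assoc (N k t) (δ t i) (v l))))) ⟩
    sum (λ t → N k t * δ t l + N k t * δ t i * v l)
      ≈⟨ ∑-distrib-+ (λ t → N k t * δ t l) (λ t → N k t * δ t i * v l) ⟩
    sum (λ t → N k t * δ t l) + sum (λ t → N k t * δ t i * v l)
      ≈⟨ +-cong (sum-unit (N k) l) (sym (*-distribʳ-sum (v l) (λ t → N k t * δ t i))) ⟩
    N k l + sum (λ t → N k t * δ t i) * v l
      ≈⟨ +-congˡ (*-congʳ (sum-unit (N k) i)) ⟩
    N k l + N k i * v l ∎

  elem-transvection : ∀ r s a → elem r s a ≋ I ◃ r ∣ a · unit s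
  elem-transvection r s a k l with k ≟ r | l ≟ s
  ... | yes _ | yes _ = +-congˡ (sym (trans (*-identityˡ _) (*-identityʳ a)))
  ... | yes _ | no _ = +-congˡ (sym (trans (*-identityˡ _) (zeroʳ a)))
  ... | no _ | _ = +-congˡ (sym (zeroˡ _))

module Generators {c ℓ} (R : CommutativeRing c ℓ) (M : ℕ) (2≤M : 2 ≤ M) where
  open CommutativeRing R
  open Matrices R (suc M)
  open RowOperations R {suc M}
  open MatrixProducts R (suc M)
  open import Relation.Binary.Reasoning.Setoid setoid

  1≤M : 1 ≤ M
  1≤M = ≤-trans (s≤s z≤n) 2≤M

  ν : Fin (suc M) → Row
  ν i = zipWith _+_ (unit (csuc i)) (unit (cpred i))

  -- u_i(a) = x_i(a) y_{i-1}(a) is I + e_iᵀ (a ν_i): the two elementary factors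
  -- act on the same row i, so they merge.
  u-transvection : ∀ i a → u i a ≋ I ◃ i ∣ a · ν i
  u-transvection i a k l = begin
    (x i a ⊗ y (cpred i) a) k l
      ≈⟨ ⊗-cong (elem-transvection i (csuc i) a) y-as-transvection k l ⟩
    ((I ◃ i ∣ a · unit (csuc i)) ⊗ (I ◃ i ∣ a · unit (cpred i))) k l
      ≈⟨ ⊗-transvection (I ◃ i ∣ a · unit (csuc i)) i (a · unit (cpred i)) k l ⟩
    transvect (transvect (I k) i (a · unit (csuc i))) i (a · unit (cpred i)) l
      ≈⟨ transvect-merge (I k) i (a · unit (csuc i)) (a · unit (cpred i))
           (scale-vanishes a (unit (csuc i)) i (δ-off-diag (csuc-no-fixpoint 1≤M i ∘ ≡-sym))) l ⟩
    I k l + I k i * (a * δ l (csuc i) + a * δ l (cpred i))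
      ≈⟨ +-congˡ (*-congˡ (sym (distribˡ a _ _))) ⟩
    (I ◃ i ∣ a · ν i) k l ∎
    where
    y-as-transvection : y (cpred i) a ≋ I ◃ i ∣ a · unit (cpred i)
    y-as-transvection =
      subst (λ r → elem r (cpred i) a ≋ I ◃ i ∣ a · unit (cpred i))
            (≡-sym (csuc-cpred i)) (elem-transvection i (cpred i) a)

  ⊗-u : ∀ {N N'} → N ≋ N' → ∀ i a → N ⊗ u i a ≋ N' ◃ i ∣ a · ν i
  ⊗-u {N' = N'} N≋N' i a k l =
    trans (⊗-cong N≋N' (u-transvection i a) k l) (⊗-transvection N' i (a · ν i) k l)

  ν-far : ∀ {i j} → j ≢ csuc i → csuc j ≢ i → ν i j ≈ 0#
  ν-far {i} {j} j≢i⁺ j⁺≢i =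
    trans (+-cong (δ-off-diag j≢i⁺) (δ-off-diag j≢i⁻)) (+-identityʳ 0#)
    where
    j≢i⁻ : j ≢ cpred i
    j≢i⁻ j≡i⁻ = j⁺≢i (≡-trans (cong csuc j≡i⁻) (csuc-cpred i))

  ν-self : ∀ i → ν i i ≈ 0#
  ν-self i = ν-far (csuc-no-fixpoint 1≤M i ∘ ≡-sym) (csuc-no-fixpoint 1≤M i)

  neighbours-distinct : ∀ i → csuc i ≢ cpred i
  neighbours-distinct i i⁺≡i⁻ =
    csuc²-no-fixpoint 2≤M i (≡-trans (cong csuc i⁺≡i⁻) (csuc-cpred i))

  ν-next : ∀ i → ν i (csuc i) ≈ 1#
  ν-next i = trans (+-cong (δ-diag (csuc i)) (δ-off-diag (neighbours-distinct i))) (+-identityʳ 1#)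

  ν-prev : ∀ i → ν i (cpred i) ≈ 1#
  ν-prev i = trans (+-cong (δ-off-diag (neighbours-distinct i ∘ ≡-sym)) (δ-diag (cpred i))) (+-identityˡ 1#)

  Adjacent : Fin (suc M) → Fin (suc M) → Set ℓ
  Adjacent i j = ν i j ≈ 1# × ν j i ≈ 1#

  adjacent-next : ∀ i → Adjacent i (csuc i)
  adjacent-next i = ν-next i , subst (λ k → ν (csuc i) k ≈ 1#) (cpred-csuc i) (ν-prev (csuc i))

  adjacent-prev : ∀ i → Adjacent i (cpred i)
  adjacent-prev i = ν-prev i , subst (λ k → ν (cpred i) k ≈ 1#) (csuc-cpred i) (ν-next (cpred i))

  u-additive : ∀ i a b → u i a ⊗ u i b ≋ u i (a + b)
  u-additive i a b k l = begin
    (u i a ⊗ u i b) k l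
      ≈⟨ ⊗-u (u-transvection i a) i b k l ⟩
    transvect (transvect (I k) i (a · ν i)) i (b · ν i) l
      ≈⟨ transvect-merge (I k) i (a · ν i) (b · ν i) (scale-vanishes a (ν i) i (ν-self i)) l ⟩
    I k l + I k i * (a * ν i l + b * ν i l)
      ≈⟨ +-congˡ (*-congˡ (sym (distribʳ (ν i l) a b))) ⟩
    (I ◃ i ∣ (a + b) · ν i) k l
      ≈⟨ u-transvection i (a + b) k l ⟨
    u i (a + b) k l ∎

  -- Relation (2): generators at non-adjacent positions commute (also when i = j).
  u-commute : ∀ i j a b → j ≢ csuc i → i ≢ csuc j → u i a ⊗ u j b ≋ u j b ⊗ u i a
  u-commute i j a b j≢i⁺ i≢j⁺ k l = begin
    (u i a ⊗ u j b) k l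
      ≈⟨ ⊗-u (u-transvection i a) j b k l ⟩
    transvect (transvect (I k) i (a · ν i)) j (b · ν j) l
      ≈⟨ transvect-comm (I k) i j (a · ν i) (b · ν j)
           (scale-vanishes a (ν i) j (ν-far j≢i⁺ (i≢j⁺ ∘ ≡-sym)))
           (scale-vanishes b (ν j) i (ν-far i≢j⁺ (j≢i⁺ ∘ ≡-sym))) l ⟩
    transvect (transvect (I k) j (b · ν j)) i (a · ν i) l
      ≈⟨ ⊗-u (u-transvection j b) i a k l ⟨
    (u j b ⊗ u i a) k l ∎

  u-braid : ∀ {i j} → Adjacent i j → ∀ a b c d → (a + c + a * b * c) * d ≈ 1# →
    u i a ⊗ u j b ⊗ u i c ≋ u j (b * c * d) ⊗ u i (a + c + a * b * c) ⊗ u j (a * b * d)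
  u-braid {i} {j} (νij≈1 , νji≈1) a b c d inverse k l = begin
    (u i a ⊗ u j b ⊗ u i c) k l
      ≈⟨ ⊗-u (⊗-u (u-transvection i a) j b) i c k l ⟩
    transvect (transvect (transvect (I k) i (a · ν i)) j (b · ν j)) i (c · ν i) l
      ≈⟨ transvect-braid (I k) i j (ν i) (ν j) a b c d (ν-self i) νij≈1 νji≈1 (ν-self j) inverse l ⟩
    transvect (transvect (transvect (I k) j ((b * c * d) · ν j)) i ((a + c + a * b * c) · ν i))
              j ((a * b * d) · ν j) l
      ≈⟨ ⊗-u (⊗-u (u-transvection j (b * c * d)) i (a + c + a * b * c)) j (a * b * d) k l ⟨
    (u j (b * c * d) ⊗ u i (a + c + a * b * c) ⊗ u j (a * b * d)) k l ∎

-- The theorem: 2n ≥ 4 cyclic positions, so Generators applies with M = 2n - 1.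
proposition5p13 : ∀ {c ℓ} (R : CommutativeRing c ℓ) (n : ℕ) → 2 ≤ n →
    let open CommutativeRing R
        open Matrices R (2 ℕ.* n)
    in ((i : Fin (2 ℕ.* n)) (a b : Carrier) → u i a ⊗ u i b ≋ u i (a + b))
       × ((i j : Fin (2 ℕ.* n)) (a b : Carrier) → i ≢ j → j ≢ csuc i → i ≢ csuc j →
            u i a ⊗ u j b ≋ u j b ⊗ u i a)
       × ((i : Fin (2 ℕ.* n)) (a b c' d⁻¹ : Carrier) → (a + c' + a * b * c') * d⁻¹ ≈ 1# →
            (u i a ⊗ u (csuc i) b ⊗ u i c'
               ≋ u (csuc i) (b * c' * d⁻¹) ⊗ u i (a + c' + a * b * c') ⊗ u (csuc i) (a * b * d⁻¹))
            × (u i a ⊗ u (cpred i) b ⊗ u i c'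
               ≋ u (cpred i) (b * c' * d⁻¹) ⊗ u i (a + c' + a * b * c') ⊗ u (cpred i) (a * b * d⁻¹)))
proposition5p13 R (suc (suc n)) (s≤s (s≤s z≤n)) =
    u-additive
  , (λ i j a b _ j≢i⁺ i≢j⁺ → u-commute i j a b j≢i⁺ i≢j⁺)
  , λ i a b c d inverse → u-braid (adjacent-next i) a b c d inverse
                        , u-braid (adjacent-prev i) a b c d inverse
  where open Generators R _ (s≤s (m≤n⇒m≤o+n n (s≤s z≤n)))
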